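{- For every positive integer $n$, $\binom{1,n}{1,2}$ equals the total number of parts in all compositions of $n+1$ (i.e. the sum, over all compositions of $n+1$ into positive parts, of the number of parts).
   Context: For a nonnegative integer $m$ and positive integers $n,q$, let $X$ be a set which is the disjoint union of $n$ "main blocks" each of size $q$ and an "additional block" of size $m$. An $(n+k)$-inset of $X$ is an $(n+k)$-element subset of $X$ that intersects every main block; their number is denoted $\binom{m,n}{k,q}$. Thus $\binom{1,n}{1,2}$ counts $(n+1)$-subsets of the union of $n$ two-element main blocks and a one-element additional block that meet every main block. -}

module Defs where

open import Data.Bool using (Bool; true; false; not; _∧_)
open import Data.Nat using (ℕ; zero; suc; _+_; _≡ᵇ_)
open import Data.List using (List; []; _∷_; _++_; map; concatMap; length; filterᵇ; upTo; cartesianProduct)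
open import Data.Vec using (Vec; []; _∷_; toList)
import Data.Vec as Vec
open import Data.Fin.Subset using (Subset; ∣_∣)
open import Data.Product using (_×_; _,_)
open import Data.Nat.ListAction using (sum)

allSubsets : (q : ℕ) → List (Subset q)
allSubsets zero = [] ∷ []
allSubsets (suc q) = map (true ∷_) (allSubsets q) ++ map (false ∷_) (allSubsets q)

vecsOf : {A : Set} → List A → (n : ℕ) → List (Vec A n)
vecsOf xs zero = [] ∷ []
vecsOf xs (suc n) = concatMap (λ x → map (x ∷_) (vecsOf xs n)) xs

-- A subset of X = (n main blocks of size q) ⊔ (additional block of size m)
-- is a pair (S , T): S i ⊆ i-th main block, T ⊆ additional block.
isInset : (m n k q : ℕ) → Vec (Subset q) n × Subset m → Bool
isInset m n k q (S , T) =
  Vec.foldr _ (λ s b → not (∣ s ∣ ≡ᵇ 0) ∧ b) true S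
  ∧ ((sum (toList (Vec.map ∣_∣ S)) + ∣ T ∣) ≡ᵇ (n + k))

-- The number  binom(m,n ; k,q)  of (n+k)-insets.
insetCount : (m n k q : ℕ) → ℕ
insetCount m n k q =
  length (filterᵇ (isInset m n k q)
    (cartesianProduct (vecsOf (allSubsets q) n) (allSubsets m)))

candidates : (L B : ℕ) → List (List ℕ)
candidates zero B = [] ∷ []
candidates (suc L) B = [] ∷ concatMap (λ x → map (x ∷_) (candidates L B)) (map suc (upTo B))

-- All compositions of N (ordered lists of positive integers summing to N).
-- Every composition of N has at most N parts, each ≤ N.
compositions : ℕ → List (List ℕ)
compositions N = filterᵇ (λ c → sum c ≡ᵇ N) (candidates N N)

totalParts : ℕ → ℕ
totalParts N = sum (map length (compositions N))

-- Both sides equal (n + 3) 2ⁿ.  With N = n + 1 main blocks of size 2 and one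
-- extra point, an (N + 1)-inset either contains the extra point, and then takes
-- exactly one point of every block (2^N choices), or it does not, and then one
-- block is taken whole and every other block contributes one point
-- (N 2^(N-1) choices).  Splitting the compositions of r + 2 according to whether
-- the first part is 1 (delete it) or larger (decrease it) gives c(r+2) = 2 c(r+1)
-- and p(r+2) = 2 p(r+1) + c(r+1) for the numbers c of compositions and p of parts,
-- hence c(r+1) = 2ʳ and p(n+2) = (n+3) 2ⁿ = 2^(n+1) + (n+1) 2ⁿ.
module Submission where

open import Data.Bool using (Bool; true; false; not; _∧_; if_then_else_)
open import Data.Fin.Subset using (Subset; ∣_∣)
open import Data.List
  using (List; []; _∷_; _++_; [_]; map; concatMap; length; filterᵇ; upTo; cartesianProduct)
open import Data.List.Properties using (map-++; map-∘; map-applyUpTo; map-upTo; upTo-∷ʳ)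
open import Data.Nat using (ℕ; zero; suc; _+_; _*_; _^_; _<_; _≤_; _≡ᵇ_; s≤s)
open import Data.Nat.ListAction using (sum)
open import Data.Nat.ListAction.Properties using (sum-++)
open import Data.Nat.Properties
open import Data.Nat.Solver using (module +-*-Solver)
open import Data.Product using (_×_; _,_)
open import Data.Vec using (Vec; _∷_; toList)
import Data.Vec as Vec
open import Function using (_∘_)
open import Relation.Nullary using (contradiction)
open import Relation.Binary.PropositionalEquality
  using (_≡_; _≢_; refl; sym; trans; cong; cong₂; module ≡-Reasoning)

open import Defs

open import Algebra.Properties.CommutativeSemigroup +-commutativeSemigroup
  using (interchange; xy∙z≈y∙xz)

open +-*-Solver using (solve; _:+_; _:*_; con; _:=_)

≡ᵇ-refl : ∀ m → (m ≡ᵇ m) ≡ true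
≡ᵇ-refl zero    = refl
≡ᵇ-refl (suc m) = ≡ᵇ-refl m

≢⇒≡ᵇ-false : ∀ m n → m ≢ n → (m ≡ᵇ n) ≡ false
≢⇒≡ᵇ-false zero    zero    m≢n = contradiction refl m≢n
≢⇒≡ᵇ-false zero    (suc n) _   = refl
≢⇒≡ᵇ-false (suc m) zero    _   = refl
≢⇒≡ᵇ-false (suc m) (suc n) m≢n = ≢⇒≡ᵇ-false m n (m≢n ∘ cong suc)

∑ : {A : Set} → (A → ℕ) → List A → ℕ
∑ f xs = sum (map f xs)

module _ {A : Set} where

  ∑-cong : {f g : A → ℕ} → (∀ x → f x ≡ g x) → ∀ xs → ∑ f xs ≡ ∑ g xs
  ∑-cong f≗g []       = refl
  ∑-cong f≗g (x ∷ xs) = cong₂ _+_ (f≗g x) (∑-cong f≗g xs)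

  ∑-zero : {f : A → ℕ} → (∀ x → f x ≡ 0) → ∀ xs → ∑ f xs ≡ 0
  ∑-zero f≗0 []       = refl
  ∑-zero f≗0 (x ∷ xs) = cong₂ _+_ (f≗0 x) (∑-zero f≗0 xs)

  ∑-++ : (f : A → ℕ) (xs ys : List A) → ∑ f (xs ++ ys) ≡ ∑ f xs + ∑ f ys
  ∑-++ f xs ys = trans (cong sum (map-++ f xs ys)) (sum-++ (map f xs) (map f ys))

  ∑-+ : (f g : A → ℕ) (xs : List A) → ∑ (λ x → f x + g x) xs ≡ ∑ f xs + ∑ g xs
  ∑-+ f g []       = refl
  ∑-+ f g (x ∷ xs) =
    trans (cong (f x + g x +_) (∑-+ f g xs)) (interchange (f x) (g x) (∑ f xs) (∑ g xs))

  ∑-if : (b : Bool) (f : A → ℕ) (xs : List A) →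
         ∑ (λ x → if b then f x else 0) xs ≡ (if b then ∑ f xs else 0)
  ∑-if true  f xs = refl
  ∑-if false f xs = ∑-zero (λ _ → refl) xs

  ∑-filterᵇ : (p : A → Bool) (f : A → ℕ) (xs : List A) →
              ∑ f (filterᵇ p xs) ≡ ∑ (λ x → if p x then f x else 0) xs
  ∑-filterᵇ p f []       = refl
  ∑-filterᵇ p f (x ∷ xs) with p x
  ... | true  = cong (f x +_) (∑-filterᵇ p f xs)
  ... | false = ∑-filterᵇ p f xs

  length≡∑1 : (xs : List A) → length xs ≡ ∑ (λ _ → 1) xs
  length≡∑1 []       = refl
  length≡∑1 (x ∷ xs) = cong suc (length≡∑1 xs)

∑-map : {A B : Set} (f : B → ℕ) (g : A → B) (xs : List A) → ∑ f (map g xs) ≡ ∑ (f ∘ g) xs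
∑-map f g xs = cong sum (sym (map-∘ xs))

module _ {A B : Set} where

  ∑-concatMap : (f : B → ℕ) (g : A → List B) (xs : List A) →
                ∑ f (concatMap g xs) ≡ ∑ (∑ f ∘ g) xs
  ∑-concatMap f g []       = refl
  ∑-concatMap f g (x ∷ xs) =
    trans (∑-++ f (g x) (concatMap g xs)) (cong (∑ f (g x) +_) (∑-concatMap f g xs))

  ∑-cartesianProduct : (f : A × B → ℕ) (xs : List A) (ys : List B) →
                       ∑ f (cartesianProduct xs ys) ≡ ∑ (λ x → ∑ (λ y → f (x , y)) ys) xs
  ∑-cartesianProduct f []       ys = refl
  ∑-cartesianProduct f (x ∷ xs) ys =
    trans (∑-++ f (map (x ,_) ys) (cartesianProduct xs ys))
          (cong₂ _+_ (∑-map f (x ,_) ys) (∑-cartesianProduct f xs ys))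

  ∑-comm : (f : A → B → ℕ) (xs : List A) (ys : List B) →
           ∑ (λ x → ∑ (f x) ys) xs ≡ ∑ (λ y → ∑ (λ x → f x y) xs) ys
  ∑-comm f []       ys = sym (∑-zero (λ _ → refl) ys)
  ∑-comm f (x ∷ xs) ys =
    trans (cong (∑ (f x) ys +_) (∑-comm f xs ys))
          (sym (∑-+ (f x) (λ y → ∑ (λ x′ → f x′ y) xs) ys))

∑-upTo-suc : (F : ℕ → ℕ) (B : ℕ) → ∑ F (upTo (suc B)) ≡ F 0 + ∑ (F ∘ suc) (upTo B)
∑-upTo-suc F B =
  cong (λ ys → F 0 + sum ys) (trans (map-applyUpTo suc F B) (sym (map-upTo (F ∘ suc) B)))

∑-upTo-∷ʳ : (F : ℕ → ℕ) (B : ℕ) → ∑ F (upTo (suc B)) ≡ ∑ F (upTo B) + F B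
∑-upTo-∷ʳ F B = begin
  ∑ F (upTo (suc B))          ≡⟨ cong (∑ F) (upTo-∷ʳ B) ⟨
  ∑ F (upTo B ++ [ B ])       ≡⟨ ∑-++ F (upTo B) [ B ] ⟩
  ∑ F (upTo B) + (F B + 0)    ≡⟨ cong (∑ F (upTo B) +_) (+-identityʳ (F B)) ⟩
  ∑ F (upTo B) + F B          ∎
  where open ≡-Reasoning

∑-upTo-rotate : (F : ℕ → ℕ) (B : ℕ) → F B ≡ 0 → ∑ F (upTo B) ≡ F 0 + ∑ (F ∘ suc) (upTo B)
∑-upTo-rotate F B FB≡0 = begin
  ∑ F (upTo B)                ≡⟨ +-identityʳ (∑ F (upTo B)) ⟨
  ∑ F (upTo B) + 0            ≡⟨ cong (∑ F (upTo B) +_) FB≡0 ⟨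
  ∑ F (upTo B) + F B          ≡⟨ ∑-upTo-∷ʳ F B ⟨
  ∑ F (upTo (suc B))          ≡⟨ ∑-upTo-suc F B ⟩
  F 0 + ∑ (F ∘ suc) (upTo B)  ∎
  where open ≡-Reasoning

compositionCount : ℕ → ℕ
compositionCount zero          = 1
compositionCount (suc zero)    = 1
compositionCount (suc (suc r)) = 2 * compositionCount (suc r)

partCount : ℕ → ℕ
partCount zero          = 0
partCount (suc zero)    = 1
partCount (suc (suc r)) = 2 * partCount (suc r) + compositionCount (suc r)

compositionCount-closed : ∀ n → compositionCount (suc n) ≡ 2 ^ n
compositionCount-closed zero    = refl
compositionCount-closed (suc n) = cong (2 *_) (compositionCount-closed n)

partCount-closed : ∀ n → partCount (suc (suc n)) ≡ (3 + n) * 2 ^ n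
partCount-closed zero    = refl
partCount-closed (suc n)
  rewrite partCount-closed n | compositionCount-closed (suc n) =
  solve 2 (λ N P → con 2 :* ((con 3 :+ N) :* P) :+ con 2 :* P := (con 4 :+ N) :* (con 2 :* P))
        refl n (2 ^ n)

-- partsFrom L s w adds up length c + w over the c ∈ candidates L t with
-- sum c + s = t, i.e. (for s ≤ t) over the compositions of t − s into at most
-- L parts.  The offset s avoids subtraction; being affine in w, partsFrom
-- records both the number of these compositions and their total number of parts.
module CompositionsOf (t : ℕ) where

  weight : ℕ → ℕ → List ℕ → ℕ
  weight s w c = if sum c + s ≡ᵇ t then length c + w else 0

  partsFrom : ℕ → ℕ → ℕ → ℕ
  partsFrom L s w = ∑ (weight s w) (candidates L t)

  partsAfterFirst : ℕ → ℕ → ℕ → ℕ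
  partsAfterFirst L s w = ∑ (λ i → partsFrom L (suc i + s) w) (upTo t)

  weight-∷ : ∀ x s w c → weight s w (x ∷ c) ≡ weight (x + s) (suc w) c
  weight-∷ x s w c =
    cong₂ (λ m k → if m ≡ᵇ t then k else 0) (xy∙z≈y∙xz x (sum c) s) (sym (+-suc (length c) w))

  weight-[]-short : ∀ s w → s < t → weight s w [] ≡ 0
  weight-[]-short s w s<t = cong (λ b → if b then w else 0) (≢⇒≡ᵇ-false s t (<⇒≢ s<t))

  partsFrom-suc : ∀ L s w → partsFrom (suc L) s w ≡ weight s w [] + partsAfterFirst L s (suc w)
  partsFrom-suc L s w = cong (weight s w [] +_) (begin
    ∑ (weight s w) (concatMap (λ x → map (x ∷_) (candidates L t)) (map suc (upTo t)))
      ≡⟨ ∑-concatMap (weight s w) _ (map suc (upTo t)) ⟩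
    ∑ (λ x → ∑ (weight s w) (map (x ∷_) (candidates L t))) (map suc (upTo t))
      ≡⟨ ∑-cong (λ x → trans (∑-map (weight s w) (x ∷_) (candidates L t))
                             (∑-cong (weight-∷ x s w) (candidates L t)))
                (map suc (upTo t)) ⟩
    ∑ (λ x → partsFrom L (x + s) (suc w)) (map suc (upTo t))
      ≡⟨ ∑-map (λ x → partsFrom L (x + s) (suc w)) suc (upTo t) ⟩
    partsAfterFirst L s (suc w) ∎)
    where open ≡-Reasoning

  partsFrom-suc-short : ∀ L s w → s < t → partsFrom (suc L) s w ≡ partsAfterFirst L s (suc w)
  partsFrom-suc-short L s w s<t =
    trans (partsFrom-suc L s w) (cong (_+ partsAfterFirst L s (suc w)) (weight-[]-short s w s<t))

  partsFrom-overshoot : ∀ L s w → t < s → partsFrom L s w ≡ 0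
  partsFrom-overshoot L s w t<s = ∑-zero vanish (candidates L t)
    where
    vanish : ∀ c → weight s w c ≡ 0
    vanish c = cong (λ b → if b then length c + w else 0)
                    (≢⇒≡ᵇ-false (sum c + s) t (>⇒≢ (<-≤-trans t<s (m≤n+m s (sum c)))))

  partsAfterFirst-overshoot : ∀ L s w → t ≤ s → partsAfterFirst L s w ≡ 0
  partsAfterFirst-overshoot L s w t≤s =
    ∑-zero (λ i → partsFrom-overshoot L (suc i + s) w (s≤s (≤-trans t≤s (m≤n+m s i)))) (upTo t)

  -- Splits off first part 1; the first parts ≥ 2, decreased by one, are the
  -- first parts for offset suc s.
  partsAfterFirst-peel : ∀ L s w →
    partsAfterFirst L s w ≡ partsFrom L (suc s) w + partsAfterFirst L (suc s) w
  partsAfterFirst-peel L s w =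
    trans (∑-upTo-rotate (λ i → partsFrom L (suc i + s) w) t
                         (partsFrom-overshoot L (suc t + s) w (s≤s (m≤m+n t s))))
          (cong (partsFrom L (suc s) w +_)
                (∑-cong (λ i → cong (λ k → partsFrom L k w) (sym (+-suc (suc i) s))) (upTo t)))

  partsFrom-exact : ∀ L w → partsFrom L t w ≡ w
  partsFrom-exact zero    w rewrite ≡ᵇ-refl t = +-identityʳ w
  partsFrom-exact (suc L) w
    rewrite partsFrom-suc L t w | partsAfterFirst-overshoot L t (suc w) ≤-refl | ≡ᵇ-refl t =
    +-identityʳ w

  partsFrom-closed : ∀ r L s w → r ≤ L → r + s ≡ t →
                     partsFrom L s w ≡ partCount r + w * compositionCount r
  partsFrom-closed zero L s w _ refl = trans (partsFrom-exact L w) (sym (*-identityʳ w))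
  partsFrom-closed (suc zero) (suc L) s w _ refl = begin
    partsFrom (suc L) s w
      ≡⟨ partsFrom-suc-short L s w ≤-refl ⟩
    partsAfterFirst L s (suc w)
      ≡⟨ partsAfterFirst-peel L s (suc w) ⟩
    partsFrom L (suc s) (suc w) + partsAfterFirst L (suc s) (suc w)
      ≡⟨ cong₂ _+_ (partsFrom-exact L (suc w)) (partsAfterFirst-overshoot L (suc s) (suc w) ≤-refl) ⟩
    suc w + 0
      ≡⟨ cong suc (trans (+-identityʳ w) (sym (*-identityʳ w))) ⟩
    1 + w * 1 ∎
    where open ≡-Reasoning
  partsFrom-closed (suc (suc r)) (suc L) s w (s≤s r+1≤L) r+2+s≡t = begin
    partsFrom (suc L) s w
      ≡⟨ partsFrom-suc-short L s w s<t ⟩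
    partsAfterFirst L s (suc w)
      ≡⟨ partsAfterFirst-peel L s (suc w) ⟩
    partsFrom L (suc s) (suc w) + partsAfterFirst L (suc s) (suc w)
      ≡⟨ cong (partsFrom L (suc s) (suc w) +_) (partsFrom-suc-short L (suc s) w 1+s<t) ⟨
    partsFrom L (suc s) (suc w) + partsFrom (suc L) (suc s) w
      ≡⟨ cong₂ _+_ (partsFrom-closed (suc r) L (suc s) (suc w) r+1≤L r+1+[1+s]≡t)
                   (partsFrom-closed (suc r) (suc L) (suc s) w (m≤n⇒m≤1+n r+1≤L) r+1+[1+s]≡t) ⟩
    (T + suc w * C) + (T + w * C)
      ≡⟨ solve 3 (λ T C W → (T :+ (con 1 :+ W) :* C) :+ (T :+ W :* C)
                             := (con 2 :* T :+ C) :+ W :* (con 2 :* C)) refl T C w ⟩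
    partCount (suc (suc r)) + w * compositionCount (suc (suc r)) ∎
    where
    open ≡-Reasoning
    T C : ℕ
    T = partCount (suc r)
    C = compositionCount (suc r)
    r+1+[1+s]≡t : suc r + suc s ≡ t
    r+1+[1+s]≡t = trans (+-suc (suc r) s) r+2+s≡t
    1+s<t : suc s < t
    1+s<t = ≤-trans (s≤s (s≤s (m≤n+m s r))) (≤-reflexive r+2+s≡t)
    s<t : s < t
    s<t = <-trans (n<1+n s) 1+s<t

totalParts≡partCount : ∀ N → totalParts N ≡ partCount N
totalParts≡partCount N = begin
  ∑ length (filterᵇ (λ c → sum c ≡ᵇ N) (candidates N N))
    ≡⟨ ∑-filterᵇ (λ c → sum c ≡ᵇ N) length (candidates N N) ⟩
  ∑ (λ c → if sum c ≡ᵇ N then length c else 0) (candidates N N)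
    ≡⟨ ∑-cong (λ c → cong₂ (λ m k → if m ≡ᵇ N then k else 0)
                           (+-identityʳ (sum c)) (+-identityʳ (length c)))
              (candidates N N) ⟨
  partsFrom N 0 0
    ≡⟨ partsFrom-closed N N 0 0 ≤-refl (+-identityʳ N) ⟩
  partCount N + 0
    ≡⟨ +-identityʳ (partCount N) ⟩
  partCount N ∎
  where
  open ≡-Reasoning
  open CompositionsOf N

allNonempty : ∀ {q N} → Vec (Subset q) N → Bool
allNonempty = Vec.foldr _ (λ s b → not (∣ s ∣ ≡ᵇ 0) ∧ b) true

totalSize : ∀ {q N} → Vec (Subset q) N → ℕ
totalSize S = sum (toList (Vec.map ∣_∣ S))

tupleCount : (q N c t : ℕ) → ℕ
tupleCount q N c t =
  ∑ (λ S → if allNonempty S ∧ (totalSize S + c ≡ᵇ t) then 1 else 0) (vecsOf (allSubsets q) N)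

insetCount≡∑tupleCount : ∀ m n k q →
  insetCount m n k q ≡ ∑ (λ T → tupleCount q n ∣ T ∣ (n + k)) (allSubsets m)
insetCount≡∑tupleCount m n k q = begin
  length (filterᵇ isIn (cartesianProduct tuples (allSubsets m)))
    ≡⟨ length≡∑1 (filterᵇ isIn (cartesianProduct tuples (allSubsets m))) ⟩
  ∑ (λ _ → 1) (filterᵇ isIn (cartesianProduct tuples (allSubsets m)))
    ≡⟨ ∑-filterᵇ isIn (λ _ → 1) (cartesianProduct tuples (allSubsets m)) ⟩
  ∑ (λ z → if isIn z then 1 else 0) (cartesianProduct tuples (allSubsets m))
    ≡⟨ ∑-cartesianProduct (λ z → if isIn z then 1 else 0) tuples (allSubsets m) ⟩
  ∑ (λ S → ∑ (λ T → if isIn (S , T) then 1 else 0) (allSubsets m)) tuples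
    ≡⟨ ∑-comm (λ S T → if isIn (S , T) then 1 else 0) tuples (allSubsets m) ⟩
  ∑ (λ T → tupleCount q n ∣ T ∣ (n + k)) (allSubsets m) ∎
  where
  open ≡-Reasoning
  isIn : Vec (Subset q) n × Subset m → Bool
  isIn = isInset m n k q
  tuples : List (Vec (Subset q) n)
  tuples = vecsOf (allSubsets q) n

tupleCount-suc : ∀ q N c t → tupleCount q (suc N) c t ≡
  ∑ (λ s → if not (∣ s ∣ ≡ᵇ 0) then tupleCount q N (∣ s ∣ + c) t else 0) (allSubsets q)
tupleCount-suc q N c t =
  trans (∑-concatMap indicator (λ s → map (s ∷_) tuples) (allSubsets q))
        (∑-cong (λ s → trans (∑-map indicator (s ∷_) tuples)
                             (trans (∑-cong (indicator-∷ s) tuples) (∑-if _ _ tuples)))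
                (allSubsets q))
  where
  tuples : List (Vec (Subset q) N)
  tuples = vecsOf (allSubsets q) N
  indicator : Vec (Subset q) (suc N) → ℕ
  indicator S = if allNonempty S ∧ (totalSize S + c ≡ᵇ t) then 1 else 0
  indicator-∷ : ∀ s S → indicator (s ∷ S) ≡
    (if not (∣ s ∣ ≡ᵇ 0) then (if allNonempty S ∧ (totalSize S + (∣ s ∣ + c) ≡ᵇ t) then 1 else 0) else 0)
  indicator-∷ s S with not (∣ s ∣ ≡ᵇ 0)
  ... | false = refl
  ... | true  = cong (λ m → if allNonempty S ∧ (m ≡ᵇ t) then 1 else 0) (xy∙z≈y∙xz ∣ s ∣ (totalSize S) c)

tupleCount₂-suc : ∀ N c t →
  tupleCount 2 (suc N) c t ≡ tupleCount 2 N (2 + c) t + 2 * tupleCount 2 N (1 + c) t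
tupleCount₂-suc = tupleCount-suc 2

tupleCount₂-below : ∀ N c t → t < N + c → tupleCount 2 N c t ≡ 0
tupleCount₂-below zero    c t t<c rewrite ≢⇒≡ᵇ-false c t (>⇒≢ t<c) = refl
tupleCount₂-below (suc N) c t t<N+1+c =
  trans (tupleCount₂-suc N c t)
        (cong₂ (λ a b → a + 2 * b)
               (tupleCount₂-below N (2 + c) t (<-≤-trans t<N+[1+c] (+-monoʳ-≤ N (n≤1+n (suc c)))))
               (tupleCount₂-below N (1 + c) t t<N+[1+c]))
  where
  t<N+[1+c] : t < N + suc c
  t<N+[1+c] = <-≤-trans t<N+1+c (≤-reflexive (sym (+-suc N c)))

tupleCount₂-minimal : ∀ N c → tupleCount 2 N c (N + c) ≡ 2 ^ N
tupleCount₂-minimal zero    c rewrite ≡ᵇ-refl c = refl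
tupleCount₂-minimal (suc N) c =
  trans (tupleCount₂-suc N c (suc N + c))
        (cong₂ (λ a b → a + 2 * b)
               (tupleCount₂-below N (2 + c) (suc N + c) N+1+c<N+[2+c])
               (trans (cong (tupleCount 2 N (1 + c)) (sym (+-suc N c))) (tupleCount₂-minimal N (suc c))))
  where
  N+1+c<N+[2+c] : suc N + c < N + (2 + c)
  N+1+c<N+[2+c] = ≤-reflexive (trans (cong suc (sym (+-suc N c))) (sym (+-suc N (suc c))))

tupleCount₂-minimal+1 : ∀ N c → tupleCount 2 (suc N) c (suc (suc N + c)) ≡ suc N * 2 ^ N
tupleCount₂-minimal+1 zero c
  rewrite ≡ᵇ-refl c | ≢⇒≡ᵇ-false c (suc c) (<⇒≢ (n<1+n c)) = refl
tupleCount₂-minimal+1 (suc N) c = begin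
  tupleCount 2 (suc (suc N)) c t
    ≡⟨ tupleCount₂-suc (suc N) c t ⟩
  tupleCount 2 (suc N) (2 + c) t + 2 * tupleCount 2 (suc N) (1 + c) t
    ≡⟨ cong₂ (λ a b → a + 2 * b)
             (trans (cong (tupleCount 2 (suc N) (2 + c)) t≡N+1+[2+c]) (tupleCount₂-minimal (suc N) (2 + c)))
             (trans (cong (tupleCount 2 (suc N) (1 + c)) t≡N+2+[1+c]) (tupleCount₂-minimal+1 N (suc c))) ⟩
  2 ^ suc N + 2 * (suc N * 2 ^ N)
    ≡⟨ solve 2 (λ X P → con 2 :* P :+ con 2 :* ((con 1 :+ X) :* P) := (con 2 :+ X) :* (con 2 :* P))
             refl N (2 ^ N) ⟩
  suc (suc N) * 2 ^ suc N ∎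
  where
  open ≡-Reasoning
  t : ℕ
  t = suc (suc (suc N) + c)
  t≡N+1+[2+c] : t ≡ suc N + (2 + c)
  t≡N+1+[2+c] = sym (trans (+-suc (suc N) (suc c)) (cong suc (+-suc (suc N) c)))
  t≡N+2+[1+c] : t ≡ suc (suc N + suc c)
  t≡N+2+[1+c] = cong suc (sym (+-suc (suc N) c))

insetCount-1-suc-1-2 : ∀ n → insetCount 1 (suc n) 1 2 ≡ (3 + n) * 2 ^ n
insetCount-1-suc-1-2 n = begin
  insetCount 1 (suc n) 1 2
    ≡⟨ insetCount≡∑tupleCount 1 (suc n) 1 2 ⟩
  tupleCount 2 (suc n) 1 (suc n + 1) + (tupleCount 2 (suc n) 0 (suc n + 1) + 0)
    ≡⟨ cong₂ (λ a b → a + (b + 0))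
             (tupleCount₂-minimal (suc n) 1)
             (trans (cong (tupleCount 2 (suc n) 0 ∘ suc) (+-suc n 0)) (tupleCount₂-minimal+1 n 0)) ⟩
  2 ^ suc n + (suc n * 2 ^ n + 0)
    ≡⟨ solve 2 (λ X P → con 2 :* P :+ ((con 1 :+ X) :* P :+ con 0) := (con 3 :+ X) :* P) refl n (2 ^ n) ⟩
  (3 + n) * 2 ^ n ∎
  where open ≡-Reasoning

mainTheorem18 : (n : ℕ) → insetCount 1 (suc n) 1 2 ≡ totalParts (suc n + 1)
mainTheorem18 n = begin
  insetCount 1 (suc n) 1 2       ≡⟨ insetCount-1-suc-1-2 n ⟩
  (3 + n) * 2 ^ n                ≡⟨ partCount-closed n ⟨
  partCount (2 + n)              ≡⟨ totalParts≡partCount (2 + n) ⟨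
  totalParts (2 + n)             ≡⟨ cong totalParts (+-comm (suc n) 1) ⟨
  totalParts (suc n + 1)         ∎
  where open ≡-Reasoning
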